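{- Let $2\le r\le 8$. Every linear intersecting $r$-partite hypergraph $H$ (with every vertex of positive degree) satisfies $\tau(H)\le (r-1)\nu(H)$, i.e. $\tau(H)\le r-1$.
   Context: A hypergraph $H$ is a set of non-empty subsets (lines) of a finite vertex set $V(H)$; the degree of a vertex is the number of lines containing it. $H$ is $r$-partite if $V(H)$ is partitioned into $r$ sets (sides) such that every line contains exactly one vertex from each side. A cover is a set of vertices meeting every line; $\tau(H)$ is the minimum size of a cover. A matching is a set of pairwise disjoint lines and $\nu(H)$ is the maximum size of a matching. $H$ is intersecting if every two lines share at least one vertex (so $\nu(H)=1$), and linear if every two distinct lines share at most one vertex. -}

module Defs where

open import Data.Nat using (ℕ)
open import Data.Fin using (Fin)
open import Data.Fin.Subset using (Subset; _∈_; ∣_∣; Nonempty)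
open import Data.List using (List)
import Data.List.Membership.Propositional as L
open import Data.List.Relation.Unary.Unique.Propositional using (Unique)
open import Data.Product using (Σ; ∃; _×_)
open import Relation.Binary.PropositionalEquality using (_≡_; _≢_)
open import Data.Nat using (_≤_)

record Hypergraph (n : ℕ) : Set where
  field
    lines    : List (Subset n)
    distinct : Unique lines
    nonEmpty : ∀ {e} → e L.∈ lines → Nonempty e
open Hypergraph public

PositiveDegrees : ∀ {n} → Hypergraph n → Set
PositiveDegrees {n} H = ∀ (v : Fin n) → ∃ λ e → e L.∈ lines H × v ∈ e

IsRPartiteVia : ∀ {n} (r : ℕ) → (Fin n → Fin r) → Hypergraph n → Set
IsRPartiteVia {n} r side H =
  ∀ {e} → e L.∈ lines H → ∀ (i : Fin r) →
    ∃ λ (v : Fin n) → v ∈ e × side v ≡ i ×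
      (∀ (w : Fin n) → w ∈ e → side w ≡ i → w ≡ v)

RPartite : ∀ {n} (r : ℕ) → Hypergraph n → Set
RPartite {n} r H = Σ (Fin n → Fin r) λ side → IsRPartiteVia r side H

Intersecting : ∀ {n} → Hypergraph n → Set
Intersecting {n} H =
  ∀ {e f} → e L.∈ lines H → f L.∈ lines H → ∃ λ (v : Fin n) → v ∈ e × v ∈ f

Linear : ∀ {n} → Hypergraph n → Set
Linear {n} H =
  ∀ {e f} → e L.∈ lines H → f L.∈ lines H → e ≢ f →
    ∀ (u v : Fin n) → u ∈ e → u ∈ f → v ∈ e → v ∈ f → u ≡ v

IsCover : ∀ {n} → Hypergraph n → Subset n → Set
IsCover {n} H C = ∀ {e} → e L.∈ lines H → ∃ λ (v : Fin n) → v ∈ e × v ∈ C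

τ≤ : ∀ {n} → Hypergraph n → ℕ → Set
τ≤ H k = ∃ λ C → IsCover H C × ∣ C ∣ ≤ k

module Submission where

-- Covers of bounded size are decidable, so it suffices to refute the
-- absence of a cover of size r - 1.  Assuming it (module NoSmallCover),
-- with m lines and deg v the number of lines through v:
--   * lines have r vertices and every side is a cover, so n ≥ r²;
--   * distinct lines meet exactly once, so by double counting
--     Σ deg = m r, Σ_{v ∈ e} deg v = m + r - 1 for every line e, and
--     Σ deg² = m (m + r - 1);
--   * 2 ≤ deg v ≤ r - 2, and for r ≥ 3 every line has at most one vertex
--     of degree two: otherwise an explicit cover of size r - 1 exists.
-- For r ≤ 3 the degree bounds clash.  For 4 ≤ r ≤ 8, summing a pointwise
-- quadratic estimate in deg v over the vertices gives an inequality in m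
-- without solutions; the two numeric facts are decided by evaluation.

open import Defs
open import Data.Nat using (ℕ; _≤_; _∸_)

open import Data.Nat using (zero; suc; _+_; _*_; _<_; z≤n; s≤s; _≤?_)
import Data.Nat as ℕ
open import Data.Nat.Properties hiding (_≟_)
open import Data.Fin using (Fin; zero; suc; _≟_; punchIn; punchOut; fromℕ<)
open import Data.Fin.Properties using (punchInᵢ≢i; punchIn-injective; punchIn-punchOut; any?)
open import Data.Fin.Subset using (Subset; _∈_; _∉_; ∣_∣; _∪_; _-_; ⁅_⁆; inside; outside)
open import Data.Fin.Subset.Properties
  using (_∈?_; ∣p∣≤∣x∷p∣; anySubset?; x∈⁅x⁆; ∣⁅x⁆∣≡1; x∈p∪q⁺; x∈p∧x≢y⇒x∈p-y; x∈p⇒∣p-x∣<∣p∣)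
open import Data.List using (List; length)
import Data.List as List
import Data.List.Membership.Propositional as L
open import Data.List.Membership.Propositional.Properties using (∈-lookup)
import Data.List.Relation.Unary.Any as Any
open import Data.List.Relation.Unary.Any.Properties using (lookup-index)
open import Data.List.Relation.Unary.Unique.Propositional using (Unique)
import Data.List.Relation.Unary.AllPairs as AllPairs
import Data.List.Relation.Unary.All as All
open import Data.Bool using (Bool; true; false; if_then_else_)
open import Data.Vec using ([]; _∷_; tabulate)
open import Data.Vec.Properties using (lookup⇒[]=; lookup∘tabulate)
open import Data.Product using (∃; _×_; _,_; proj₁; proj₂)
open import Data.Sum using (inj₁; inj₂)
open import Data.Empty using (⊥; ⊥-elim)
open import Data.Unit using (tt)
open import Function using (_∘_)
open import Relation.Nullary using (¬_; Dec; does; yes; no; _×-dec_)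
open import Relation.Nullary.Decidable using (decidable-stable; dec-true; map′; toWitness; _→-dec_; ¬?)
open import Relation.Binary.PropositionalEquality
open import Algebra.Properties.Semiring.Sum +-*-semiring
  using (sum; sum-syntax; ∑-distrib-+; ∑-comm; *-distribˡ-sum; sum-cong-≗; sum-remove)


-- The 0/1 indicator of a decidable proposition.  It is defined through
-- the boolean 'does' so that it computes on decisions built by 'map′'.
𝟙 : ∀ {p} {P : Set p} → Dec P → ℕ
𝟙 d = if does d then 1 else 0

module _ {p} {P : Set p} where

  𝟙-yes : (d : Dec P) → P → 𝟙 d ≡ 1
  𝟙-yes (yes _) _ = refl
  𝟙-yes (no ¬p) p = ⊥-elim (¬p p)

  𝟙-no : (d : Dec P) → ¬ P → 𝟙 d ≡ 0
  𝟙-no (yes p) ¬p = ⊥-elim (¬p p)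
  𝟙-no (no _) _ = refl

  𝟙≤1 : (d : Dec P) → 𝟙 d ≤ 1
  𝟙≤1 (yes _) = s≤s z≤n
  𝟙≤1 (no _) = z≤n

  𝟙-idem : (d : Dec P) → 𝟙 d * 𝟙 d ≡ 𝟙 d
  𝟙-idem (yes _) = refl
  𝟙-idem (no _) = refl

𝟙*𝟙-pos : ∀ {p q} {P : Set p} {Q : Set q} (d : Dec P) (d′ : Dec Q) →
  1 ≤ 𝟙 d * 𝟙 d′ → P × Q
𝟙*𝟙-pos (yes p) (yes q) _ = p , q

+𝟙[≡0]≡1 : ∀ {c} → c ≤ 1 → c + 𝟙 (c ℕ.≟ 0) ≡ 1
+𝟙[≡0]≡1 z≤n = refl
+𝟙[≡0]≡1 (s≤s z≤n) = refl

sum-mono : ∀ {n} {f g : Fin n → ℕ} → (∀ i → f i ≤ g i) → sum f ≤ sum g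
sum-mono {zero} _ = z≤n
sum-mono {suc n} f≤g = +-mono-≤ (f≤g zero) (sum-mono (f≤g ∘ suc))

∑-*ˡ : ∀ {n} c (f : Fin n → ℕ) → ∑[ i < n ] (c * f i) ≡ c * sum f
∑-*ˡ c f = sym (*-distribˡ-sum c f)

sum-const : ∀ n c → ∑[ i < n ] c ≡ n * c
sum-const zero c = refl
sum-const (suc n) c = cong (c +_) (sum-const n c)

sum-zero : ∀ {n} (f : Fin n → ℕ) → (∀ i → f i ≡ 0) → sum f ≡ 0
sum-zero {n} f f≡0 = trans (sum-cong-≗ f≡0) (trans (sum-const n 0) (*-zeroʳ n))

sum-pointMass : ∀ {n} (f : Fin n → ℕ) j → (∀ i → i ≢ j → f i ≡ 0) → sum f ≡ f j
sum-pointMass {suc n} f j zeroElsewhere = begin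
  sum f                      ≡⟨ sum-remove {i = j} f ⟩
  f j + sum (f ∘ punchIn j)  ≡⟨ cong (f j +_) (sum-zero (f ∘ punchIn j) rest≡0) ⟩
  f j + 0                    ≡⟨ +-identityʳ (f j) ⟩
  f j                        ∎
  where
  open ≡-Reasoning
  rest≡0 : ∀ i → f (punchIn j i) ≡ 0
  rest≡0 i = zeroElsewhere (punchIn j i) (punchInᵢ≢i j i)

sum-δ : ∀ {n} (j : Fin n) → ∑[ i < n ] 𝟙 (j ≟ i) ≡ 1
sum-δ j = trans (sum-pointMass _ j (λ i i≢j → 𝟙-no (j ≟ i) (i≢j ∘ sym))) (𝟙-yes (j ≟ j) refl)

sum-member : ∀ {n} (f : Fin n → ℕ) i → f i ≤ sum f
sum-member {suc n} f i = ≤-trans (m≤m+n (f i) _) (≤-reflexive (sym (sum-remove {i = i} f)))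

sum-pair : ∀ {n} (f : Fin n → ℕ) {i j} → j ≢ i → f i + f j ≤ sum f
sum-pair {suc n} f {i} {j} j≢i = begin
  f i + f j                                     ≡⟨ cong (λ k → f i + f k) (sym (punchIn-punchOut j≢i′)) ⟩
  f i + f (punchIn i (punchOut j≢i′))           ≤⟨ +-monoʳ-≤ (f i) (sum-member (f ∘ punchIn i) _) ⟩
  f i + sum (f ∘ punchIn i)                     ≡⟨ sym (sum-remove {i = i} f) ⟩
  sum f                                         ∎
  where
  open ≤-Reasoning
  j≢i′ : i ≢ j
  j≢i′ = j≢i ∘ sym

sum-witness : ∀ {n} (f : Fin n → ℕ) → 1 ≤ sum f → ∃ λ i → 1 ≤ f i
sum-witness {suc n} f pos with f zero in eq
... | suc _ = zero , subst (1 ≤_) (sym eq) (s≤s z≤n)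
... | zero = let (i , p) = sum-witness (f ∘ suc) pos in suc i , p

sum-atMostOne : ∀ {n} (f : Fin n → ℕ) → (∀ i → f i ≤ 1) →
  (∀ i j → 1 ≤ f i → 1 ≤ f j → i ≡ j) → sum f ≤ 1
sum-atMostOne f f≤1 samePoint with any? (λ i → 1 ≤? f i)
... | yes (j , fj≥1) = ≤-trans (≤-reflexive (sum-pointMass f j vanish)) (f≤1 j)
  where
  vanish : ∀ i → i ≢ j → f i ≡ 0
  vanish i i≢j = n<1⇒n≡0 (≰⇒> (λ fi≥1 → i≢j (samePoint i j fi≥1 fj≥1)))
... | no noneBig = ≤-trans (≤-reflexive (sum-zero f vanish)) z≤n
  where
  vanish : ∀ i → f i ≡ 0
  vanish i = n<1⇒n≡0 (≰⇒> (λ fi≥1 → noneBig (i , fi≥1)))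

uniqueOther : ∀ {n} (f : Fin n → ℕ) i → sum f ≡ f i + 1 →
  ∃ λ j → j ≢ i × 1 ≤ f j × (∀ k → k ≢ i → 1 ≤ f k → k ≡ j)
uniqueOther {suc n} f i total = punchIn i j′ , punchInᵢ≢i i j′ , restⱼ′≥1 , onlyOne
  where
  rest : Fin n → ℕ
  rest = f ∘ punchIn i
  rest≡1 : sum rest ≡ 1
  rest≡1 = +-cancelˡ-≡ (f i) (sum rest) 1 (trans (sym (sum-remove {i = i} f)) total)
  witness : ∃ λ j′ → 1 ≤ rest j′
  witness = sum-witness rest (≤-reflexive (sym rest≡1))
  j′ : Fin n
  j′ = proj₁ witness
  restⱼ′≥1 : 1 ≤ rest j′
  restⱼ′≥1 = proj₂ witness
  onlyOne : ∀ k → k ≢ i → 1 ≤ f k → k ≡ punchIn i j′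
  onlyOne k k≢i fk≥1 = decidable-stable (k ≟ punchIn i j′) λ k≢j → 1+n≰n (begin
      2                   ≤⟨ +-mono-≤ restⱼ′≥1 (subst (1 ≤_) (cong f (sym k≡)) fk≥1) ⟩
      rest j′ + rest k′   ≤⟨ sum-pair rest (λ k′≡j′ → k≢j (trans (sym k≡) (cong (punchIn i) k′≡j′))) ⟩
      sum rest            ≡⟨ rest≡1 ⟩
      1                   ∎)
    where
    open ≤-Reasoning
    k′ : Fin n
    k′ = punchOut (k≢i ∘ sym)
    k≡ : punchIn i k′ ≡ k
    k≡ = punchIn-punchOut (k≢i ∘ sym)

sum-exchange : ∀ {m n} (a : Fin m → Fin n → ℕ) (g : Fin n → ℕ) →
  ∑[ v < n ] (g v * ∑[ i < m ] a i v) ≡ ∑[ i < m ] ∑[ v < n ] (a i v * g v)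
sum-exchange {m} {n} a g = begin
  ∑[ v < n ] (g v * ∑[ i < m ] a i v)  ≡⟨ sum-cong-≗ (λ v → *-distribˡ-sum (g v) (λ i → a i v)) ⟩
  ∑[ v < n ] ∑[ i < m ] (g v * a i v)  ≡⟨ ∑-comm (λ v i → g v * a i v) ⟩
  ∑[ i < m ] ∑[ v < n ] (g v * a i v)  ≡⟨ sum-cong-≗ (λ i → sum-cong-≗ (λ v → *-comm (g v) (a i v))) ⟩
  ∑[ i < m ] ∑[ v < n ] (a i v * g v)  ∎
  where open ≡-Reasoning

χ : ∀ {n} → Subset n → Fin n → ℕ
χ p v = 𝟙 (v ∈? p)

χ∈ : ∀ {n} {p : Subset n} {v} → v ∈ p → χ p v ≡ 1
χ∈ {p = p} {v} = 𝟙-yes (v ∈? p)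

∣p∣≡∑χ : ∀ {n} (p : Subset n) → ∣ p ∣ ≡ sum (χ p)
∣p∣≡∑χ [] = refl
∣p∣≡∑χ (inside ∷ p) = cong suc (∣p∣≡∑χ p)
∣p∣≡∑χ (outside ∷ p) = ∣p∣≡∑χ p

select : ∀ {n p} {P : Fin n → Set p} → (∀ v → Dec (P v)) → Subset n
select P? = tabulate (does ∘ P?)

select-∈ : ∀ {n p} {P : Fin n → Set p} (P? : ∀ v → Dec (P v)) {v} → P v → v ∈ select P?
select-∈ P? {v} pv = lookup⇒[]= v _ (trans (lookup∘tabulate (does ∘ P?) v) (dec-true (P? v) pv))

∣select∣ : ∀ {n p} {P : Fin n → Set p} (P? : ∀ v → Dec (P v)) →
  ∣ select P? ∣ ≡ ∑[ v < n ] 𝟙 (P? v)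
∣select∣ P? = go (does ∘ P?)
  where
  go : ∀ {k} (b : Fin k → Bool) → ∣ tabulate b ∣ ≡ ∑[ v < k ] (if b v then 1 else 0)
  go {zero} b = refl
  go {suc k} b with b zero
  ... | true = cong suc (go (b ∘ suc))
  ... | false = go (b ∘ suc)

∣p∪q∣≤∣p∣+∣q∣ : ∀ {n} (p q : Subset n) → ∣ p ∪ q ∣ ≤ ∣ p ∣ + ∣ q ∣
∣p∪q∣≤∣p∣+∣q∣ [] [] = z≤n
∣p∪q∣≤∣p∣+∣q∣ (inside ∷ p) (s ∷ q) =
  s≤s (≤-trans (∣p∪q∣≤∣p∣+∣q∣ p q) (+-monoʳ-≤ ∣ p ∣ (∣p∣≤∣x∷p∣ s q)))
∣p∪q∣≤∣p∣+∣q∣ (outside ∷ p) (inside ∷ q) =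
  ≤-trans (s≤s (∣p∪q∣≤∣p∣+∣q∣ p q)) (≤-reflexive (sym (+-suc ∣ p ∣ ∣ q ∣)))
∣p∪q∣≤∣p∣+∣q∣ (outside ∷ p) (outside ∷ q) = ∣p∪q∣≤∣p∣+∣q∣ p q

isCover? : ∀ {n} (H : Hypergraph n) (C : Subset n) → Dec (IsCover H C)
isCover? H C = map′ All.lookup All.tabulate
  (All.all? (λ e → any? (λ v → (v ∈? e) ×-dec (v ∈? C))) (lines H))

τ≤? : ∀ {n} (H : Hypergraph n) (k : ℕ) → Dec (τ≤ H k)
τ≤? H k = anySubset? (λ C → isCover? H C ×-dec (∣ C ∣ ≤? k))

-- The pointwise degree estimate: for 2 ≤ d ≤ r - 2,
--   d² - (r + 1) d + 3 (r - 2) ≤ [d = 2] (r - 4) d / 2,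
-- since the left side is a convex quadratic in d vanishing at 3 and at
-- r - 2, and equals r - 4 at d = 2.  For r ≤ 8 it is checked by evaluation.
DegreeEstimate : ℕ → ℕ → Set
DegreeEstimate r d = 2 ≤ d → d ≤ r ∸ 2 →
  2 * (d * d + 3 * (r ∸ 2)) ≤ 2 * (r + 1) * d + (r ∸ 4) * (𝟙 (d ℕ.≟ 2) * d)

degreeEstimate : ∀ {r} d → r ≤ 8 → DegreeEstimate r d
degreeEstimate {r} d r≤8 2≤d d≤r∸2 =
  toWitness {a? = allUpTo? (λ r → allUpTo? (degreeEstimate? r) 7) 9} tt
    (s≤s r≤8) (s≤s (≤-trans d≤r∸2 (∸-monoˡ-≤ 2 r≤8))) 2≤d d≤r∸2
  where
  degreeEstimate? : ∀ r d → Dec (DegreeEstimate r d)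
  degreeEstimate? r d = 2 ≤? d →-dec d ≤? r ∸ 2 →-dec _ ≤? _

-- The inequality obtained by summing the degree estimate over all n
-- vertices of a hypergraph with m lines, where t bounds the incidences
-- at vertices of degree 2.
CountingInequality : ℕ → ℕ → ℕ → ℕ → Set
CountingInequality r m n t =
  2 * (m * (m + (r ∸ 1)) + n * (3 * (r ∸ 2))) ≤ 2 * (r + 1) * (m * r) + (r ∸ 4) * t

-- For 4 ≤ r ≤ 8 it has no solution with n ≥ r², t ≤ m and
-- m + r - 1 ≤ r (r - 2): the extreme case n = r², t = m is checked by
-- evaluation, using m ≤ 48.
countingInequalityFails : ∀ {r m n t} → 4 ≤ r → r ≤ 8 → m + (r ∸ 1) ≤ r * (r ∸ 2) →
  r * r ≤ n → t ≤ m → ¬ CountingInequality r m n t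
countingInequalityFails {r} {m} {n} {t} 4≤r r≤8 mBound r²≤n t≤m holds =
  toWitness {a? = allUpTo? (λ r → allUpTo? (extremalFails? r) 49) 9} tt
    (s≤s r≤8) (s≤s m≤48) 4≤r extremalHolds
  where
  ExtremalFails : ℕ → ℕ → Set
  ExtremalFails r m = 4 ≤ r → ¬ CountingInequality r m (r * r) m
  extremalFails? : ∀ r m → Dec (ExtremalFails r m)
  extremalFails? r m = 4 ≤? r →-dec ¬? (_ ≤? _)
  m≤48 : m ≤ 48
  m≤48 = ≤-trans (m≤m+n m (r ∸ 1)) (≤-trans mBound (*-mono-≤ r≤8 (∸-monoˡ-≤ 2 r≤8)))
  extremalHolds : CountingInequality r m (r * r) m
  extremalHolds = ≤-trans
    (*-monoʳ-≤ 2 (+-monoʳ-≤ (m * (m + (r ∸ 1))) (*-monoˡ-≤ (3 * (r ∸ 2)) r²≤n)))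
    (≤-trans holds (+-monoʳ-≤ (2 * (r + 1) * (m * r)) (*-monoʳ-≤ (r ∸ 4) t≤m)))

avoidOne : ∀ {r} → 2 ≤ r → (a : Fin r) → ∃ λ c → c ≢ a
avoidOne (s≤s (s≤s _)) a = punchIn a zero , punchInᵢ≢i a zero

avoidTwo : ∀ {r} → 3 ≤ r → (a b : Fin r) → ∃ λ c → c ≢ a × c ≢ b
avoidTwo {suc (suc (suc k))} (s≤s (s≤s (s≤s _))) a b with b ≟ a
... | yes refl = punchIn a zero , punchInᵢ≢i a zero , punchInᵢ≢i a zero
... | no b≢a = punchIn a (punchIn b′ zero) , punchInᵢ≢i a _ , c≢b
  where
  a≢b : a ≢ b
  a≢b = b≢a ∘ sym
  b′ : Fin (suc (suc k))
  b′ = punchOut a≢b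
  c≢b : punchIn a (punchIn b′ zero) ≢ b
  c≢b eq = punchInᵢ≢i b′ zero
    (punchIn-injective a _ _ (trans eq (sym (punchIn-punchOut a≢b))))

module NoSmallCover {n : ℕ} (r : ℕ) (2≤r : 2 ≤ r) (H : Hypergraph n)
  (side : Fin n → Fin r) (partite : IsRPartiteVia r side H)
  (linear : Linear H) (intersecting : Intersecting H)
  (positiveDegrees : PositiveDegrees H) (noSmallCover : ¬ τ≤ H (r ∸ 1)) where

  m : ℕ
  m = length (lines H)

  line : Fin m → Subset n
  line = List.lookup (lines H)

  line∈H : ∀ i → line i L.∈ lines H
  line∈H = ∈-lookup

  lineIndex : ∀ {e} → e L.∈ lines H → ∃ λ i → line i ≡ e
  lineIndex e∈H = Any.index e∈H , sym (lookup-index e∈H)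

  line-injective : ∀ {i j} → line i ≡ line j → i ≡ j
  line-injective = go (distinct H)
    where
    go : ∀ {xs : List (Subset n)} → Unique xs → ∀ {i j} →
      List.lookup xs i ≡ List.lookup xs j → i ≡ j
    go (_ AllPairs.∷ _) {zero} {zero} _ = refl
    go (x≢ AllPairs.∷ _) {zero} {suc j} eq = ⊥-elim (All.lookup x≢ (∈-lookup j) eq)
    go (x≢ AllPairs.∷ _) {suc i} {zero} eq = ⊥-elim (All.lookup x≢ (∈-lookup i) (sym eq))
    go (_ AllPairs.∷ unique) {suc i} {suc j} eq = cong suc (go unique eq)

  sideVertex : ∀ i k → ∃ λ u → u ∈ line i × side u ≡ k
  sideVertex i k with partite (line∈H i) k
  ... | u , u∈i , su≡k , _ = u , u∈i , su≡k

  sidesDiffer : ∀ {i u v} → u ∈ line i → v ∈ line i → side u ≡ side v → u ≡ v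
  sidesDiffer {i} {u} {v} u∈i v∈i su≡sv with partite (line∈H i) (side v)
  ... | _ , _ , _ , unique = trans (unique u u∈i su≡sv) (sym (unique v v∈i refl))

  meetPoint : ∀ i j → ∃ λ v → v ∈ line i × v ∈ line j
  meetPoint i j = intersecting (line∈H i) (line∈H j)

  meetUnique : ∀ {i j u v} → i ≢ j → u ∈ line i → u ∈ line j → v ∈ line i → v ∈ line j → u ≡ v
  meetUnique i≢j = linear (line∈H _) (line∈H _) (i≢j ∘ line-injective) _ _

  lineThrough : ∀ v → ∃ λ i → v ∈ line i
  lineThrough v with positiveDegrees v
  ... | e , e∈H , v∈e with lineIndex e∈H
  ... | i , refl = i , v∈e

  notCover : (C : Subset n) → (∀ i → ∃ λ v → v ∈ line i × v ∈ C) → ∣ C ∣ < r → ⊥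
  notCover C meets small = noSmallCover (C , cover , ∸-monoˡ-≤ 1 small)
    where
    cover : IsCover H C
    cover e∈H with lineIndex e∈H
    ... | i , refl = meets i

  I : Fin m → Fin n → ℕ
  I i = χ (line i)

  deg : Fin n → ℕ
  deg v = ∑[ i < m ] I i v

  σ : Fin r → Fin n → ℕ
  σ k v = 𝟙 (side v ≟ k)

  oneOnEachSide : ∀ i k → ∑[ v < n ] (I i v * σ k v) ≡ 1
  oneOnEachSide i k with partite (line∈H i) k
  ... | u , u∈i , su≡k , unique =
    trans (sum-pointMass _ u vanish) (cong₂ _*_ (χ∈ u∈i) (𝟙-yes (side u ≟ k) su≡k))
    where
    vanish : ∀ v → v ≢ u → I i v * σ k v ≡ 0
    vanish v v≢u with v ∈? line i | side v ≟ k
    ... | yes v∈i | yes sv≡k = ⊥-elim (v≢u (unique v v∈i sv≡k))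
    ... | no _ | _ = refl
    ... | yes _ | no _ = refl

  lineSize : ∀ i → sum (I i) ≡ r
  lineSize i = begin
    sum (I i)                              ≡⟨ sum-cong-≗ (λ v → sym (trans (cong (I i v *_) (sum-δ (side v))) (*-identityʳ (I i v)))) ⟩
    ∑[ v < n ] (I i v * ∑[ k < r ] σ k v)  ≡⟨ sum-exchange σ (I i) ⟩
    ∑[ k < r ] ∑[ v < n ] (σ k v * I i v)  ≡⟨ sum-cong-≗ (λ k → trans (sum-cong-≗ (λ v → *-comm (σ k v) (I i v))) (oneOnEachSide i k)) ⟩
    ∑[ k < r ] 1                           ≡⟨ sum-const r 1 ⟩
    r * 1                                  ≡⟨ *-identityʳ r ⟩
    r                                      ∎
    where open ≡-Reasoning

  lineCard : ∀ i → ∣ line i ∣ ≡ r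
  lineCard i = trans (∣p∣≡∑χ (line i)) (lineSize i)

  -- Every side is a cover, so it has at least r vertices, and n ≥ r².
  sideLarge : ∀ k → r ≤ sum (σ k)
  sideLarge k = ≮⇒≥ λ small → notCover sideSet meets (subst (_< r) (sym (∣select∣ (λ v → side v ≟ k))) small)
    where
    sideSet : Subset n
    sideSet = select (λ v → side v ≟ k)
    meets : ∀ i → ∃ λ v → v ∈ line i × v ∈ sideSet
    meets i with sideVertex i k
    ... | u , u∈i , su≡k = u , u∈i , select-∈ (λ v → side v ≟ k) su≡k

  enoughVertices : r * r ≤ n
  enoughVertices = begin
    r * r                         ≡⟨ sym (sum-const r r) ⟩
    ∑[ k < r ] r                  ≤⟨ sum-mono sideLarge ⟩
    ∑[ k < r ] ∑[ v < n ] σ k v   ≡⟨ ∑-comm σ ⟩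
    ∑[ v < n ] ∑[ k < r ] σ k v   ≡⟨ sum-cong-≗ (λ v → sum-δ (side v)) ⟩
    ∑[ v < n ] 1                  ≡⟨ sum-const n 1 ⟩
    n * 1                         ≡⟨ *-identityʳ n ⟩
    n                             ∎
    where open ≤-Reasoning

  meetOnce : ∀ {i j} → i ≢ j → ∑[ v < n ] (I i v * I j v) ≡ 1
  meetOnce {i} {j} i≢j with meetPoint i j
  ... | u , u∈i , u∈j = trans (sum-pointMass _ u vanish) (cong₂ _*_ (χ∈ u∈i) (χ∈ u∈j))
    where
    vanish : ∀ v → v ≢ u → I i v * I j v ≡ 0
    vanish v v≢u with v ∈? line i | v ∈? line j
    ... | yes v∈i | yes v∈j = ⊥-elim (v≢u (meetUnique i≢j v∈i v∈j u∈i u∈j))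
    ... | no _ | _ = refl
    ... | yes _ | no _ = refl

  lineMeeting : ∀ i j → ∑[ v < n ] (I i v * I j v) ≡ 1 + (r ∸ 1) * 𝟙 (j ≟ i)
  lineMeeting i j with j ≟ i
  ... | no j≢i = trans (meetOnce (j≢i ∘ sym)) (cong suc (sym (*-zeroʳ (r ∸ 1))))
  ... | yes refl = begin
    ∑[ v < n ] (I i v * I i v)  ≡⟨ sum-cong-≗ (λ v → 𝟙-idem (v ∈? line i)) ⟩
    sum (I i)                   ≡⟨ lineSize i ⟩
    r                           ≡⟨ sym (m+[n∸m]≡n (≤-trans (s≤s z≤n) 2≤r)) ⟩
    1 + (r ∸ 1)                 ≡⟨ cong suc (sym (*-identityʳ (r ∸ 1))) ⟩
    1 + (r ∸ 1) * 1             ∎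
    where open ≡-Reasoning

  incidences : ∀ (g : Fin n → ℕ) →
    ∑[ v < n ] (g v * deg v) ≡ ∑[ i < m ] ∑[ v < n ] (I i v * g v)
  incidences g = sum-exchange I g

  degreeSum : sum deg ≡ m * r
  degreeSum = begin
    sum deg                          ≡⟨ sum-cong-≗ (λ v → sym (*-identityˡ (deg v))) ⟩
    ∑[ v < n ] (1 * deg v)           ≡⟨ incidences (λ _ → 1) ⟩
    ∑[ i < m ] ∑[ v < n ] (I i v * 1) ≡⟨ sum-cong-≗ (λ i → trans (sum-cong-≗ (λ v → *-identityʳ (I i v))) (lineSize i)) ⟩
    ∑[ i < m ] r                     ≡⟨ sum-const m r ⟩
    m * r                            ∎
    where open ≡-Reasoning

  -- Every other line meets line i once: the degrees along a line add up to m + r - 1.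
  lineDegree : ∀ i → ∑[ v < n ] (I i v * deg v) ≡ m + (r ∸ 1)
  lineDegree i = begin
    ∑[ v < n ] (I i v * deg v)                                 ≡⟨ incidences (I i) ⟩
    ∑[ j < m ] ∑[ v < n ] (I j v * I i v)                      ≡⟨ sum-cong-≗ (λ j → lineMeeting j i) ⟩
    ∑[ j < m ] (1 + (r ∸ 1) * 𝟙 (i ≟ j))                       ≡⟨ ∑-distrib-+ (λ _ → 1) (λ j → (r ∸ 1) * 𝟙 (i ≟ j)) ⟩
    ∑[ j < m ] 1 + ∑[ j < m ] ((r ∸ 1) * 𝟙 (i ≟ j))            ≡⟨ cong₂ _+_ (sum-const m 1) (∑-*ˡ (r ∸ 1) (λ j → 𝟙 (i ≟ j))) ⟩
    m * 1 + (r ∸ 1) * ∑[ j < m ] 𝟙 (i ≟ j)                     ≡⟨ cong₂ _+_ (*-identityʳ m) (cong ((r ∸ 1) *_) (sum-δ i)) ⟩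
    m + (r ∸ 1) * 1                                            ≡⟨ cong (m +_) (*-identityʳ (r ∸ 1)) ⟩
    m + (r ∸ 1)                                                ∎
    where open ≡-Reasoning

  degreeSquareSum : ∑[ v < n ] (deg v * deg v) ≡ m * (m + (r ∸ 1))
  degreeSquareSum = begin
    ∑[ v < n ] (deg v * deg v)             ≡⟨ incidences deg ⟩
    ∑[ i < m ] ∑[ v < n ] (I i v * deg v)  ≡⟨ sum-cong-≗ lineDegree ⟩
    ∑[ i < m ] (m + (r ∸ 1))               ≡⟨ sum-const m (m + (r ∸ 1)) ⟩
    m * (m + (r ∸ 1))                      ∎
    where open ≡-Reasoning

  -- Every vertex has degree at least 2: if v lay on line i only, line i
  -- minus v would be a cover of size r - 1.
  minDegree : ∀ v → 2 ≤ deg v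
  minDegree v with lineThrough v
  ... | i , v∈i = ≮⇒≥ λ deg<2 → notCover (line i - v) (meets deg<2)
    (subst (∣ line i - v ∣ <_) (lineCard i) (x∈p⇒∣p-x∣<∣p∣ v∈i))
    where
    meets : deg v < 2 → ∀ j → ∃ λ u → u ∈ line j × u ∈ line i - v
    meets _ j with j ≟ i
    ... | yes refl with avoidOne 2≤r (side v)
    ... | k , k≢sv with sideVertex i k
    ... | u , u∈i , su≡k =
      u , u∈i , x∈p∧x≢y⇒x∈p-y u∈i (λ u≡v → k≢sv (trans (sym su≡k) (cong side u≡v)))
    meets deg<2 j | no j≢i with meetPoint i j
    ... | u , u∈i , u∈j = u , u∈j , x∈p∧x≢y⇒x∈p-y u∈i u≢v
      where
      u≢v : u ≢ v
      u≢v refl = <⇒≱ deg<2 (≤-trans (≤-reflexive (sym (cong₂ _+_ (χ∈ u∈i) (χ∈ u∈j))))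
                                    (sum-pair (λ l → I l u) j≢i))

  common : Fin n → Fin n → ℕ
  common w y = ∑[ i < m ] (I i w * I i y)

  common≤1 : ∀ {w y} → y ≢ w → common w y ≤ 1
  common≤1 {w} {y} y≢w = sum-atMostOne _ (λ i → *-mono-≤ (𝟙≤1 (w ∈? line i)) (𝟙≤1 (y ∈? line i))) sameLine
    where
    sameLine : ∀ i j → 1 ≤ I i w * I i y → 1 ≤ I j w * I j y → i ≡ j
    sameLine i j onI onJ with 𝟙*𝟙-pos (w ∈? line i) (y ∈? line i) onI
                            | 𝟙*𝟙-pos (w ∈? line j) (y ∈? line j) onJ
    ... | w∈i , y∈i | w∈j , y∈j =
      decidable-stable (i ≟ j) λ i≢j → y≢w (meetUnique i≢j y∈i y∈j w∈i w∈j)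

  common-sameSide : ∀ {w y} → side y ≡ side w → y ≢ w → common w y ≡ 0
  common-sameSide {w} {y} sy≡sw y≢w = sum-zero _ vanish
    where
    vanish : ∀ i → I i w * I i y ≡ 0
    vanish i with w ∈? line i | y ∈? line i
    ... | yes w∈i | yes y∈i = ⊥-elim (y≢w (sidesDiffer y∈i w∈i sy≡sw))
    ... | no _ | _ = refl
    ... | yes _ | no _ = refl

  commonCount : ∀ w (g : Fin n → ℕ) → (∀ i → w ∈ line i → ∑[ y < n ] (I i y * g y) ≡ 1) →
    ∑[ y < n ] (g y * common w y) ≡ deg w
  commonCount w g weightOne = begin
    ∑[ y < n ] (g y * common w y)                  ≡⟨ sum-exchange (λ i y → I i w * I i y) g ⟩
    ∑[ i < m ] ∑[ y < n ] (I i w * I i y * g y)    ≡⟨ sum-cong-≗ (λ i → sum-cong-≗ (λ y → *-assoc (I i w) (I i y) (g y))) ⟩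
    ∑[ i < m ] ∑[ y < n ] (I i w * (I i y * g y))  ≡⟨ sum-cong-≗ (λ i → trans (∑-*ˡ (I i w) (λ y → I i y * g y)) (perLine i)) ⟩
    deg w                                          ∎
    where
    open ≡-Reasoning
    perLine : ∀ i → I i w * ∑[ y < n ] (I i y * g y) ≡ I i w
    perLine i with w ∈? line i
    ... | yes w∈i = trans (*-identityˡ _) (weightOne i w∈i)
    ... | no _ = refl

  throughLine : ∀ {j w} → w ∉ line j → ∑[ y < n ] (I j y * common w y) ≡ deg w
  throughLine {j} {w} w∉j = commonCount w (I j) λ i w∈i →
    meetOnce (λ { refl → w∉j w∈i })

  throughSide : ∀ w k → ∑[ y < n ] (σ k y * common w y) ≡ deg w
  throughSide w k = commonCount w (σ k) λ i _ → oneOnEachSide i k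

  unseen : Fin m → Fin n → ℕ
  unseen j w = ∑[ v < n ] (I j v * 𝟙 (common w v ℕ.≟ 0))

  -- Along a line j avoiding w, each vertex is either on a line with w
  -- (counted by throughLine) or unseen from w: deg w + unseen j w = r.
  degreeDeficit : ∀ {j w} → w ∉ line j → deg w + unseen j w ≡ r
  degreeDeficit {j} {w} w∉j = begin
    deg w + unseen j w                                          ≡⟨ cong (_+ unseen j w) (sym (throughLine w∉j)) ⟩
    ∑[ v < n ] (I j v * common w v) + unseen j w                ≡⟨ sym (∑-distrib-+ (λ v → I j v * common w v) _) ⟩
    ∑[ v < n ] (I j v * common w v + I j v * 𝟙 (common w v ℕ.≟ 0)) ≡⟨ sum-cong-≗ perVertex ⟩
    sum (I j)                                                   ≡⟨ lineSize j ⟩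
    r                                                           ∎
    where
    open ≡-Reasoning
    perVertex : ∀ v → I j v * common w v + I j v * 𝟙 (common w v ℕ.≟ 0) ≡ I j v
    perVertex v with v ∈? line j
    ... | no _ = refl
    ... | yes v∈j = trans (cong₂ _+_ (*-identityˡ (common w v)) (*-identityˡ (𝟙 (common w v ℕ.≟ 0))))
                          (+𝟙[≡0]≡1 (common≤1 {w} {v} λ { refl → w∉j v∈j }))

  unseenAt : ∀ {j w v} → v ∈ line j → common w v ≡ 0 → I j v * 𝟙 (common w v ℕ.≟ 0) ≡ 1
  unseenAt {w = w} {v} v∈j c≡0 = cong₂ _*_ (χ∈ v∈j) (𝟙-yes (common w v ℕ.≟ 0) c≡0)

  ownSideUnseen : ∀ {j w} → w ∉ line j → ∃ λ u → u ∈ line j × side u ≡ side w ×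
    I j u * 𝟙 (common w u ℕ.≟ 0) ≡ 1
  ownSideUnseen {j} {w} w∉j with sideVertex j (side w)
  ... | u , u∈j , su≡sw = u , u∈j , su≡sw ,
    unseenAt {j} {w} u∈j (common-sameSide {w} {u} su≡sw λ { refl → w∉j u∈j })

  -- Some line avoids w, otherwise {w} would be a cover.
  lineAvoiding : ∀ w → ∃ λ j → w ∉ line j
  lineAvoiding w with any? (λ j → ¬? (w ∈? line j))
  ... | yes found = found
  ... | no none = ⊥-elim (notCover ⁅ w ⁆ meets (subst (_< r) (sym (∣⁅x⁆∣≡1 w)) 2≤r))
    where
    meets : ∀ j → ∃ λ v → v ∈ line j × v ∈ ⁅ w ⁆
    meets j = w , decidable-stable (w ∈? line j) (λ w∉j → none (j , w∉j)) , x∈⁅x⁆ w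

  degree<r : ∀ w → deg w < r
  degree<r w with lineAvoiding w
  ... | j , w∉j with ownSideUnseen w∉j
  ... | u , _ , _ , unseenU = begin
    suc (deg w)         ≡⟨ +-comm 1 (deg w) ⟩
    deg w + 1           ≤⟨ +-monoʳ-≤ (deg w) (subst (_≤ unseen j w) unseenU (sum-member _ u)) ⟩
    deg w + unseen j w  ≡⟨ degreeDeficit w∉j ⟩
    r                   ∎
    where open ≤-Reasoning

  collinear : ∀ {j w y} → w ∈ line j → y ∈ line j → 1 ≤ common w y
  collinear {j} {w} {y} w∈j y∈j =
    ≤-trans (≤-reflexive (sym (cong₂ _*_ (χ∈ w∈j) (χ∈ y∈j)))) (sum-member (λ i → I i w * I i y) j)

  -- A line j avoiding w with an unseen vertex y off the side of w has two
  -- unseen vertices, y and the vertex on the side of w: deg w + 2 ≤ r.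
  twoUnseen : ∀ {j w y} → w ∉ line j → y ∈ line j → side y ≢ side w → common w y ≡ 0 →
    deg w + 2 ≤ r
  twoUnseen {j} {w} {y} w∉j y∈j sy≢sw c≡0 with ownSideUnseen w∉j
  ... | u , _ , su≡sw , unseenU = begin
    deg w + 2                        ≡⟨ cong (deg w +_) (sym (cong₂ _+_ unseenU (unseenAt {j} {w} y∈j c≡0))) ⟩
    deg w + (unseenAtU + unseenAtY)  ≤⟨ +-monoʳ-≤ (deg w) (sum-pair (λ v → I j v * 𝟙 (common w v ℕ.≟ 0)) y≢u) ⟩
    deg w + unseen j w               ≡⟨ degreeDeficit w∉j ⟩
    r                                ∎
    where
    open ≤-Reasoning
    unseenAtU unseenAtY : ℕ
    unseenAtU = I j u * 𝟙 (common w u ℕ.≟ 0)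
    unseenAtY = I j y * 𝟙 (common w y ℕ.≟ 0)
    y≢u : y ≢ u
    y≢u y≡u = sy≢sw (trans (cong side y≡u) su≡sw)

  -- If every vertex off the side of w shares a line with w, then a side
  -- k ≠ side w is covered by the lines through w, so deg w ≥ r.
  allSeen : ∀ w → (∀ y → side y ≢ side w → 1 ≤ common w y) → r ≤ deg w
  allSeen w seen with avoidOne 2≤r (side w)
  ... | k , k≢sw = begin
    r                               ≤⟨ sideLarge k ⟩
    sum (σ k)                       ≤⟨ sum-mono bound ⟩
    ∑[ y < n ] (σ k y * common w y) ≡⟨ throughSide w k ⟩
    deg w                           ∎
    where
    open ≤-Reasoning
    bound : ∀ y → σ k y ≤ σ k y * common w y
    bound y with side y ≟ k
    ... | yes sy≡k = ≤-trans (seen y (λ sy≡sw → k≢sw (trans (sym sy≡k) sy≡sw)))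
                             (≤-reflexive (sym (*-identityˡ (common w y))))
    ... | no _ = z≤n

  maxDegree : ∀ w → deg w ≤ r ∸ 2
  maxDegree w with any? (λ y → ¬? (side y ≟ side w) ×-dec (common w y ℕ.≟ 0))
  ... | no noneUnseen = ⊥-elim (<⇒≱ (degree<r w) (allSeen w seen))
    where
    seen : ∀ y → side y ≢ side w → 1 ≤ common w y
    seen y sy≢sw = n≢0⇒n>0 (λ c≡0 → noneUnseen (y , sy≢sw , c≡0))
  ... | yes (y , sy≢sw , c≡0) with lineThrough y
  ... | j , y∈j = ∸-monoˡ-≤ 2 (subst (_≤ r) (+-comm (deg w) 2) (twoUnseen w∉j y∈j sy≢sw c≡0))
    where
    w∉j : w ∉ line j
    w∉j w∈j = 1+n≰n (≤-trans (collinear w∈j y∈j) (≤-reflexive c≡0))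

  secondLine : ∀ {i x} → x ∈ line i → deg x ≡ 2 →
    ∃ λ j → j ≢ i × (∀ k → k ≢ i → x ∈ line k → k ≡ j)
  secondLine {i} {x} x∈i deg≡2
    with uniqueOther (λ k → I k x) i (trans deg≡2 (cong (_+ 1) (sym (χ∈ x∈i))))
  ... | j , j≢i , _ , onlyJ = j , j≢i , λ k k≢i x∈k → onlyJ k k≢i (≤-reflexive (sym (χ∈ x∈k)))

  -- Two distinct vertices x, y of line i whose other lines are jx, jy,
  -- meeting in z, would make (line i minus x and y) ∪ {z} a cover of
  -- size r - 1 (for r ≥ 3 the first part still meets line i).
  degreeTwoCover : 3 ≤ r → ∀ {i x y jx jy z} → x ∈ line i → y ∈ line i → x ≢ y →
    (∀ k → k ≢ i → x ∈ line k → k ≡ jx) → (∀ k → k ≢ i → y ∈ line k → k ≡ jy) →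
    z ∈ line jx → z ∈ line jy → ⊥
  degreeTwoCover 3≤r {i} {x} {y} {jx} {jy} {z} x∈i y∈i x≢y onlyX onlyY z∈jx z∈jy =
    notCover C meets small
    where
    C : Subset n
    C = (line i - x - y) ∪ ⁅ z ⁆
    inC : ∀ {v} → v ∈ line i → v ≢ x → v ≢ y → v ∈ C
    inC v∈i v≢x v≢y = x∈p∪q⁺ (inj₁ (x∈p∧x≢y⇒x∈p-y (x∈p∧x≢y⇒x∈p-y v∈i v≢x) v≢y))
    z∈C : z ∈ C
    z∈C = x∈p∪q⁺ (inj₂ (x∈⁅x⁆ z))
    meets : ∀ k → ∃ λ v → v ∈ line k × v ∈ C
    meets k with k ≟ i
    ... | yes refl with avoidTwo 3≤r (side x) (side y)
    ... | c , c≢sx , c≢sy with sideVertex i c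
    ... | u , u∈i , su≡c = u , u∈i ,
      inC u∈i (λ u≡x → c≢sx (trans (sym su≡c) (cong side u≡x)))
              (λ u≡y → c≢sy (trans (sym su≡c) (cong side u≡y)))
    meets k | no k≢i with meetPoint i k
    ... | v , v∈i , v∈k with v ≟ x | v ≟ y
    ... | yes refl | _ = z , subst (λ l → z ∈ line l) (sym (onlyX k k≢i v∈k)) z∈jx , z∈C
    ... | no _ | yes refl = z , subst (λ l → z ∈ line l) (sym (onlyY k k≢i v∈k)) z∈jy , z∈C
    ... | no v≢x | no v≢y = v , v∈k , inC v∈i v≢x v≢y
    small : ∣ C ∣ < r
    small = begin-strict
      ∣ C ∣                            ≤⟨ ∣p∪q∣≤∣p∣+∣q∣ (line i - x - y) ⁅ z ⁆ ⟩
      ∣ line i - x - y ∣ + ∣ ⁅ z ⁆ ∣   ≡⟨ cong (∣ line i - x - y ∣ +_) (∣⁅x⁆∣≡1 z) ⟩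
      ∣ line i - x - y ∣ + 1           ≡⟨ +-comm _ 1 ⟩
      suc ∣ line i - x - y ∣           <⟨ s≤s (x∈p⇒∣p-x∣<∣p∣ (x∈p∧x≢y⇒x∈p-y y∈i (x≢y ∘ sym))) ⟩
      suc ∣ line i - x ∣               ≤⟨ x∈p⇒∣p-x∣<∣p∣ x∈i ⟩
      ∣ line i ∣                       ≡⟨ lineCard i ⟩
      r                                ∎
      where open ≤-Reasoning

  degreeTwoUnique : 3 ≤ r → ∀ {i x y} → x ∈ line i → y ∈ line i → deg x ≡ 2 → deg y ≡ 2 → x ≡ y
  degreeTwoUnique 3≤r {i} {x} {y} x∈i y∈i dx dy with secondLine x∈i dx | secondLine y∈i dy
  ... | jx , _ , onlyX | jy , _ , onlyY with meetPoint jx jy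
  ... | z , z∈jx , z∈jy = decidable-stable (x ≟ y) λ x≢y →
    degreeTwoCover 3≤r x∈i y∈i x≢y onlyX onlyY z∈jx z∈jy

  degreeTwoIncidences : 3 ≤ r → ∑[ v < n ] (𝟙 (deg v ℕ.≟ 2) * deg v) ≤ m
  degreeTwoIncidences 3≤r = begin
    ∑[ v < n ] (𝟙 (deg v ℕ.≟ 2) * deg v)              ≡⟨ incidences (λ v → 𝟙 (deg v ℕ.≟ 2)) ⟩
    ∑[ i < m ] ∑[ v < n ] (I i v * 𝟙 (deg v ℕ.≟ 2))   ≤⟨ sum-mono perLine ⟩
    ∑[ i < m ] 1                                      ≡⟨ sum-const m 1 ⟩
    m * 1                                             ≡⟨ *-identityʳ m ⟩
    m                                                 ∎
    where
    open ≤-Reasoning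
    perLine : ∀ i → ∑[ v < n ] (I i v * 𝟙 (deg v ℕ.≟ 2)) ≤ 1
    perLine i = sum-atMostOne _ (λ v → *-mono-≤ (𝟙≤1 (v ∈? line i)) (𝟙≤1 (deg v ℕ.≟ 2))) same
      where
      same : ∀ x y → 1 ≤ I i x * 𝟙 (deg x ℕ.≟ 2) → 1 ≤ I i y * 𝟙 (deg y ℕ.≟ 2) → x ≡ y
      same x y onX onY with 𝟙*𝟙-pos (x ∈? line i) (deg x ℕ.≟ 2) onX
                          | 𝟙*𝟙-pos (y ∈? line i) (deg y ℕ.≟ 2) onY
      ... | x∈i , dx | y∈i , dy = degreeTwoUnique 3≤r x∈i y∈i dx dy

  fewLines : Fin m → m + (r ∸ 1) ≤ r * (r ∸ 2)
  fewLines i = begin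
    m + (r ∸ 1)                     ≡⟨ sym (lineDegree i) ⟩
    ∑[ v < n ] (I i v * deg v)      ≤⟨ sum-mono (λ v → *-monoʳ-≤ (I i v) (maxDegree v)) ⟩
    ∑[ v < n ] (I i v * (r ∸ 2))    ≡⟨ sum-cong-≗ (λ v → *-comm (I i v) (r ∸ 2)) ⟩
    ∑[ v < n ] ((r ∸ 2) * I i v)    ≡⟨ ∑-*ˡ (r ∸ 2) (I i) ⟩
    (r ∸ 2) * sum (I i)             ≡⟨ cong ((r ∸ 2) *_) (lineSize i) ⟩
    (r ∸ 2) * r                     ≡⟨ *-comm (r ∸ 2) r ⟩
    r * (r ∸ 2)                     ∎
    where open ≤-Reasoning

  summedEstimate : r ≤ 8 → CountingInequality r m n (∑[ v < n ] (𝟙 (deg v ℕ.≟ 2) * deg v))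
  summedEstimate r≤8 = begin
    2 * (m * (m + (r ∸ 1)) + n * K)                                    ≡⟨ sym lhs ⟩
    ∑[ v < n ] (2 * (deg v * deg v + K))                               ≤⟨ sum-mono estimate ⟩
    ∑[ v < n ] (2 * (r + 1) * deg v + (r ∸ 4) * (𝟙 (deg v ℕ.≟ 2) * deg v)) ≡⟨ rhs ⟩
    2 * (r + 1) * (m * r) + (r ∸ 4) * ∑[ v < n ] (𝟙 (deg v ℕ.≟ 2) * deg v) ∎
    where
    open ≤-Reasoning
    K : ℕ
    K = 3 * (r ∸ 2)
    estimate : ∀ v → 2 * (deg v * deg v + K) ≤ 2 * (r + 1) * deg v + (r ∸ 4) * (𝟙 (deg v ℕ.≟ 2) * deg v)
    estimate v = degreeEstimate (deg v) r≤8 (minDegree v) (maxDegree v)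
    lhs : ∑[ v < n ] (2 * (deg v * deg v + K)) ≡ 2 * (m * (m + (r ∸ 1)) + n * K)
    lhs = trans (∑-*ˡ 2 (λ v → deg v * deg v + K)) (cong (2 *_)
            (trans (∑-distrib-+ (λ v → deg v * deg v) (λ _ → K)) (cong₂ _+_ degreeSquareSum (sum-const n K))))
    rhs : ∑[ v < n ] (2 * (r + 1) * deg v + (r ∸ 4) * (𝟙 (deg v ℕ.≟ 2) * deg v)) ≡
          2 * (r + 1) * (m * r) + (r ∸ 4) * ∑[ v < n ] (𝟙 (deg v ℕ.≟ 2) * deg v)
    rhs = trans (∑-distrib-+ (λ v → 2 * (r + 1) * deg v) (λ v → (r ∸ 4) * (𝟙 (deg v ℕ.≟ 2) * deg v)))
            (cong₂ _+_ (trans (∑-*ˡ (2 * (r + 1)) deg) (cong (2 * (r + 1) *_) degreeSum))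
                       (∑-*ˡ (r ∸ 4) (λ v → 𝟙 (deg v ℕ.≟ 2) * deg v)))

  someVertex : Fin n
  someVertex = fromℕ< (≤-trans (*-mono-≤ 1≤r 1≤r) enoughVertices)
    where
    1≤r : 1 ≤ r
    1≤r = ≤-trans (s≤s z≤n) 2≤r

  impossible : r ≤ 8 → ⊥
  impossible r≤8 with 4 ≤? r
  ... | no r<4 = 1+n≰n (≤-trans (minDegree someVertex)
                         (≤-trans (maxDegree someVertex) (∸-monoˡ-≤ 2 (≤-pred (≰⇒> r<4)))))
  ... | yes 4≤r with lineThrough someVertex
  ... | i , _ = countingInequalityFails 4≤r r≤8 (fewLines i) enoughVertices
                  (degreeTwoIncidences (≤-trans (n≤1+n 3) 4≤r)) (summedEstimate r≤8)

corollary2p5 : (r : ℕ) → 2 ≤ r → r ≤ 8 → (n : ℕ) → (H : Hypergraph n) →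
    RPartite r H → Linear H → Intersecting H → PositiveDegrees H →
    τ≤ H (r ∸ 1)
corollary2p5 r 2≤r r≤8 n H (side , partite) linear intersecting positiveDegrees =
  decidable-stable (τ≤? H (r ∸ 1)) λ noSmallCover →
    NoSmallCover.impossible r 2≤r H side partite linear intersecting positiveDegrees noSmallCover r≤8
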